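{- Define binary words $X_{ -2}=X_{ -1}=X_0=0$ and $X_n=X_{n-1}\overline{X_{n-3}}$ for $n\ge1$, where $\overline{\cdot}$ is the letter-wise complement $0\leftrightarrow1$, and let ${\bf aj}={\bf aj}[0]{\bf aj}[1]\cdots$ be the limit of $(X_n)$. For $i\in\{0,1\}$ let $J_i=\{n\ge0:{\bf aj}[n]=i\}$. Then every integer $\ge10$ is a sum of two (not necessarily distinct) elements of $J_0$, and every integer $\ge2$ is a sum of two (not necessarily distinct) elements of $J_1$. -}

module Defs where

open import Data.Bool using (Bool; true; false; not)
open import Data.Nat using (ℕ; zero; suc; _+_)
open import Data.List using (List; []; _∷_; _++_; map)
open import Relation.Binary.PropositionalEquality using (_≡_)

-- Letters: 0 is 'false', 1 is 'true'; complement is 'not'.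

-- X k = X_{k-2} of the paper (shift by 2 so indices start at 0):
--   X_{-2} = X_{-1} = X_0 = 0,   X_n = X_{n-1} ++ complement (X_{n-3})  (n ≥ 1).
X : ℕ → List Bool
X zero = false ∷ []
X (suc zero) = false ∷ []
X (suc (suc zero)) = false ∷ []
X (suc (suc (suc k))) = X (suc (suc k)) ++ map not (X k)

-- n-th letter of a word (default used only out of range, never for aj below).
nth : List Bool → ℕ → Bool
nth [] _ = false
nth (x ∷ _) zero = x
nth (_ ∷ xs) (suc n) = nth xs n

-- The limit word aj: each X_n is a prefix of X_{n+1} and |X_n| ≥ n+1 (paper indexing),
-- so aj[n] is the n-th letter of X_n (= X (n + 2) here).
aj : ℕ → Bool
aj n = nth (X (n + 2)) n

J : Bool → ℕ → Set
J i n = aj n ≡ i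

-- Call a word mixed when its letters at the offsets 0, 1, 2, 3, 5, 6 are not all equal.
-- Every 7-letter window of aj is mixed. Along the recursion X (k + 3) = X (k + 2) ++ complement (X k),
-- a window of X (k + 3) ++ z lies either in X (k + 2) followed by the first six letters of
-- complement (X k), which are those of complement (X 6), or in complement (X k ++ complement z);
-- so by induction every X (n + 6) followed by X 6 or its complement has only mixed windows.
-- Hence every translate m + offsets meets both J false and J true. As 17 ∸ j ∈ J false and
-- 41 ∸ j ∈ J true for every offset j, each n ≥ 17 (resp. n ≥ 41) is (m + j) + (c ∸ j) with
-- both summands in J; the finitely many smaller n are checked by computation.

module Submission where

open import Defs
open import Data.Bool using (Bool; true; false; not; _∧_; _∨_; _xor_; T)
open import Data.Bool.Properties using (not-involutive; T-∧) renaming (_≟_ to _≟ᵇ_)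
open import Data.Bool.ListAction using (any)
open import Data.List using (List; []; _∷_; _++_; map; take; length)
open import Data.List.Properties
  using ( ++-assoc; ++-identityʳ; map-++; map-∘; map-cong; map-id; take-take
        ; length-++; length-map; length-++-≤ˡ)
open import Data.List.Relation.Unary.All as All using (All)
open import Data.List.Relation.Unary.Any as Any using (Any; here; there)
open import Data.List.Relation.Unary.Any.Properties using (any⁻; map⁻)
open import Data.List.Membership.Propositional using (_∈_; find)
open import Data.Nat using (ℕ; zero; suc; _+_; _∸_; _≤_; _<_; _≤′_; ≤′-refl; ≤′-step; _≤?_; _<?_; z≤n; s≤s)
open import Data.Nat.Properties
  using ( ≤-refl; ≤-trans; <⇒≤; ≤⇒≤′; ≮⇒≥; m≤n⇒m⊓n≡m; m≤m+n; m≤n+m; +-assoc; +-comm; +-suc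
        ; +-mono-≤; +-monoʳ-≤; +-monoˡ-≤; m+[n∸m]≡n; m+n∸m≡n; m∸n+n≡m; anyUpTo?; allUpTo?
        ; module ≤-Reasoning)
open import Data.Product using (_×_; ∃; ∃₂; _,_; proj₁; proj₂)
open import Function using (_∘_)
open import Function.Bundles using (Equivalence)
open import Relation.Nullary using (Dec; yes; no; contradiction)
open import Relation.Nullary.Decidable using (map′; _×-dec_; _→-dec_; from-yes)
open import Relation.Unary using (Decidable)
open import Relation.Binary.PropositionalEquality
  using (_≡_; _≢_; refl; sym; trans; cong; cong₂; subst; subst₂; module ≡-Reasoning)

open Equivalence using (to; from)

offsets : List ℕ
offsets = 0 ∷ 1 ∷ 2 ∷ 3 ∷ 5 ∷ 6 ∷ []

mixed : List Bool → Bool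
mixed (a ∷ b ∷ c ∷ d ∷ _ ∷ f ∷ g ∷ _) = any (a xor_) (b ∷ c ∷ d ∷ f ∷ g ∷ [])
mixed _                               = true  -- short words constrain nothing

allMixed : List Bool → Bool
allMixed []           = true
allMixed w@(_ ∷ rest) = mixed w ∧ allMixed rest

xor-not-not : ∀ a b → not a xor not b ≡ a xor b
xor-not-not true  b = refl
xor-not-not false b = not-involutive b

any-xor-map-not : ∀ a xs → any (not a xor_) (map not xs) ≡ any (a xor_) xs
any-xor-map-not a []       = refl
any-xor-map-not a (x ∷ xs) = cong₂ _∨_ (xor-not-not a x) (any-xor-map-not a xs)

mixed-map-not : ∀ w → mixed (map not w) ≡ mixed w
mixed-map-not (a ∷ b ∷ c ∷ d ∷ _ ∷ f ∷ g ∷ _) = any-xor-map-not a (b ∷ c ∷ d ∷ f ∷ g ∷ [])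
mixed-map-not []                              = refl
mixed-map-not (_ ∷ [])                        = refl
mixed-map-not (_ ∷ _ ∷ [])                    = refl
mixed-map-not (_ ∷ _ ∷ _ ∷ [])                = refl
mixed-map-not (_ ∷ _ ∷ _ ∷ _ ∷ [])            = refl
mixed-map-not (_ ∷ _ ∷ _ ∷ _ ∷ _ ∷ [])        = refl
mixed-map-not (_ ∷ _ ∷ _ ∷ _ ∷ _ ∷ _ ∷ [])    = refl

allMixed-map-not : ∀ w → allMixed (map not w) ≡ allMixed w
allMixed-map-not []           = refl
allMixed-map-not w@(_ ∷ rest) = cong₂ _∧_ (mixed-map-not w) (allMixed-map-not rest)

mixed-take : ∀ w → mixed (take 7 w) ≡ mixed w
mixed-take (_ ∷ _ ∷ _ ∷ _ ∷ _ ∷ _ ∷ _ ∷ _) = refl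
mixed-take []                           = refl
mixed-take (_ ∷ [])                     = refl
mixed-take (_ ∷ _ ∷ [])                 = refl
mixed-take (_ ∷ _ ∷ _ ∷ [])             = refl
mixed-take (_ ∷ _ ∷ _ ∷ _ ∷ [])         = refl
mixed-take (_ ∷ _ ∷ _ ∷ _ ∷ _ ∷ [])     = refl
mixed-take (_ ∷ _ ∷ _ ∷ _ ∷ _ ∷ _ ∷ []) = refl

take-++-take : ∀ {A : Set} {n m} (xs ys : List A) → n ≤ m → take n (xs ++ take m ys) ≡ take n (xs ++ ys)
take-++-take {n = n} {m} [] ys n≤m = trans (take-take n m ys) (cong (λ k → take k ys) (m≤n⇒m⊓n≡m n≤m))
take-++-take {n = zero}  (x ∷ xs) ys _   = refl
take-++-take {n = suc n} (x ∷ xs) ys n<m = cong (x ∷_) (take-++-take xs ys (<⇒≤ n<m))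

mixed-++-take : ∀ x xs ys → mixed (x ∷ xs ++ take 6 ys) ≡ mixed (x ∷ xs ++ ys)
mixed-++-take x xs ys = begin
  mixed (x ∷ xs ++ take 6 ys)          ≡⟨ sym (mixed-take (x ∷ xs ++ take 6 ys)) ⟩
  mixed (x ∷ take 6 (xs ++ take 6 ys)) ≡⟨ cong (mixed ∘ (x ∷_)) (take-++-take {n = 6} xs ys ≤-refl) ⟩
  mixed (x ∷ take 6 (xs ++ ys))        ≡⟨ mixed-take (x ∷ xs ++ ys) ⟩
  mixed (x ∷ xs ++ ys)                 ∎
  where open ≡-Reasoning

allMixed-++ : ∀ xs ys → T (allMixed (xs ++ take 6 ys)) → T (allMixed ys) → T (allMixed (xs ++ ys))
allMixed-++ []       ys _ hys = hys
allMixed-++ (x ∷ xs) ys h hys =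
  let hx , hxs = to T-∧ h
  in from T-∧ (subst T (mixed-++-take x xs ys) hx , allMixed-++ xs ys hxs hys)

X-step : ∀ k → ∃ λ e → X (suc k) ≡ X k ++ e
X-step zero          = [] , refl
X-step (suc zero)    = [] , refl
X-step (suc (suc k)) = map not (X k) , refl

X-extends : ∀ {k K} → k ≤′ K → ∃ λ e → X K ≡ X k ++ e
X-extends ≤′-refl = [] , sym (++-identityʳ _)
X-extends {k} (≤′-step {K} k≤K) =
  let e , X-K = X-extends k≤K
      e′ , X-sucK = X-step K
  in e ++ e′ , (begin
       X (suc K)         ≡⟨ X-sucK ⟩
       X K ++ e′         ≡⟨ cong (_++ e′) X-K ⟩
       (X k ++ e) ++ e′  ≡⟨ ++-assoc (X k) e e′ ⟩
       X k ++ e ++ e′    ∎)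
  where open ≡-Reasoning

map-not-not : ∀ z → map not (map not z) ≡ z
map-not-not z = trans (sym (map-∘ z)) (trans (map-cong not-involutive z) (map-id z))

take-6-map-not-X : ∀ n z → take 6 (map not (X (n + 6)) ++ z) ≡ map not (X 6)
take-6-map-not-X n z with X-extends {6} {n + 6} (≤⇒≤′ (m≤n+m 6 n))
... | e , X-n+6 rewrite X-n+6 = refl

allMixed-X-step : ∀ n z → T (allMixed (X (suc (suc n) + 6) ++ map not (X 6)))
                → T (allMixed (X (n + 6) ++ map not z))
                → T (allMixed (X (suc (suc (suc n)) + 6) ++ z))
allMixed-X-step n z hA hB =
  subst (T ∘ allMixed) (sym (++-assoc A (map not B) z))
        (allMixed-++ A (map not B ++ z) hA′ (subst T complemented hB))
  where
  open ≡-Reasoning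
  A = X (suc (suc n) + 6)
  B = X (n + 6)
  hA′ : T (allMixed (A ++ take 6 (map not B ++ z)))
  hA′ = subst (λ u → T (allMixed (A ++ u))) (sym (take-6-map-not-X n z)) hA
  complemented : allMixed (B ++ map not z) ≡ allMixed (map not B ++ z)
  complemented = begin
    allMixed (B ++ map not z)                   ≡⟨ sym (allMixed-map-not (B ++ map not z)) ⟩
    allMixed (map not (B ++ map not z))         ≡⟨ cong allMixed (map-++ not B (map not z)) ⟩
    allMixed (map not B ++ map not (map not z)) ≡⟨ cong (allMixed ∘ (map not B ++_)) (map-not-not z) ⟩
    allMixed (map not B ++ z)                   ∎

allMixed-X : ∀ n → T (allMixed (X (n + 6) ++ X 6)) × T (allMixed (X (n + 6) ++ map not (X 6)))
allMixed-X 0 = _ , _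
allMixed-X 1 = _ , _
allMixed-X 2 = _ , _
allMixed-X (suc (suc (suc n))) =
  let _ , before = allMixed-X (suc (suc n))
      withX6 , withComplement = allMixed-X n
  in allMixed-X-step n (X 6) before withComplement , allMixed-X-step n (map not (X 6)) before withX6

nth-++ˡ : ∀ {i} xs ys → i < length xs → nth (xs ++ ys) i ≡ nth xs i
nth-++ˡ {zero}  (x ∷ xs) ys _         = refl
nth-++ˡ {suc i} (x ∷ xs) ys (s≤s i<n) = nth-++ˡ xs ys i<n

length-X : ∀ k → k < length (X (k + 2))
length-X 0 = s≤s z≤n
length-X 1 = s≤s (s≤s z≤n)
length-X 2 = s≤s (s≤s (s≤s z≤n))
length-X (suc (suc (suc k))) = begin
  4 + k                                                 ≡⟨ +-comm 1 (3 + k) ⟩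
  (3 + k) + 1                                           ≤⟨ +-mono-≤ (length-X (suc (suc k))) (≤-trans (s≤s z≤n) (length-X k)) ⟩
  length (X (2 + k + 2)) + length (X (k + 2))           ≡⟨ cong (length (X (2 + k + 2)) +_) (sym (length-map not (X (k + 2)))) ⟩
  length (X (2 + k + 2)) + length (map not (X (k + 2))) ≡⟨ sym (length-++ (X (2 + k + 2))) ⟩
  length (X (2 + k + 2) ++ map not (X (k + 2)))         ∎
  where open ≤-Reasoning

X-prefix-of-aj : ∀ {i K} → i + 2 ≤ K → i < length (X K) × nth (X K) i ≡ aj i
X-prefix-of-aj {i} i+2≤K with X-extends (≤⇒≤′ i+2≤K)
... | e , X-K rewrite X-K =
  ≤-trans (length-X i) (length-++-≤ˡ (X (i + 2))) , nth-++ˡ (X (i + 2)) e (length-X i)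

xor-other : ∀ {a x b} → a ≢ b → T (a xor x) → x ≡ b
xor-other {true}  {false} {false} _   _  = refl
xor-other {false} {true}  {true}  _   _  = refl
xor-other {true}  {false} {true}  a≢b _  = contradiction refl a≢b
xor-other {false} {true}  {false} a≢b _  = contradiction refl a≢b
xor-other {true}  {true}          _   ()
xor-other {false} {false}         _   ()

mixed-contains : ∀ bit w → 7 ≤ length w → T (mixed w) → Any (λ j → nth w j ≡ bit) offsets
mixed-contains bit w@(a ∷ b ∷ c ∷ d ∷ _ ∷ f ∷ g ∷ _) _ h with a ≟ᵇ bit
... | yes a≡bit = here a≡bit
... | no  a≢bit =
  there (map⁻ {f = nth w} (Any.map (xor-other a≢bit) (any⁻ (a xor_) (b ∷ c ∷ d ∷ f ∷ g ∷ []) h)))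
mixed-contains bit []                            ()                                     _
mixed-contains bit (_ ∷ [])                      (s≤s ())                               _
mixed-contains bit (_ ∷ _ ∷ [])                  (s≤s (s≤s ()))                         _
mixed-contains bit (_ ∷ _ ∷ _ ∷ [])              (s≤s (s≤s (s≤s ())))                   _
mixed-contains bit (_ ∷ _ ∷ _ ∷ _ ∷ [])          (s≤s (s≤s (s≤s (s≤s ()))))             _
mixed-contains bit (_ ∷ _ ∷ _ ∷ _ ∷ _ ∷ [])      (s≤s (s≤s (s≤s (s≤s (s≤s ())))))       _
mixed-contains bit (_ ∷ _ ∷ _ ∷ _ ∷ _ ∷ _ ∷ [])  (s≤s (s≤s (s≤s (s≤s (s≤s (s≤s ())))))) _

allMixed-contains : ∀ bit m w → m + 7 ≤ length w → T (allMixed w) → Any (λ j → nth w (m + j) ≡ bit) offsets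
allMixed-contains bit zero    w@(_ ∷ _) 7≤ h         = mixed-contains bit w 7≤ (proj₁ (to T-∧ h))
allMixed-contains bit (suc m) (_ ∷ w)   (s≤s m+7≤) h = allMixed-contains bit m w m+7≤ (proj₂ (to T-∧ h))

offsets-meet-J : ∀ bit m → ∃ λ j → j ∈ offsets × J bit (m + j)
offsets-meet-J bit m =
  let j , j∈ , hj = find (allMixed-contains bit m W long (proj₁ (allMixed-X (m + 2))))
  in j , j∈ , trans (sym (letter (All.lookup offsets≤6 j∈))) hj
  where
  K = m + 2 + 6
  W = X K ++ X 6
  offsets≤6 : All (_≤ 6) offsets
  offsets≤6 = from-yes (All.all? (_≤? 6) offsets)
  position : ∀ {j} → j ≤ 6 → m + j + 2 ≤ K
  position {j} j≤6 = subst₂ _≤_ (sym (+-assoc m j 2)) (sym (+-assoc m 2 6)) (+-monoʳ-≤ m (+-monoˡ-≤ 2 j≤6))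
  letter : ∀ {j} → j ≤ 6 → nth W (m + j) ≡ aj (m + j)
  letter j≤6 = let inside , letter-X = X-prefix-of-aj (position j≤6) in trans (nth-++ˡ (X K) (X 6) inside) letter-X
  long : m + 7 ≤ length W
  long = subst (_≤ length W) (sym (+-suc m 6)) (≤-trans (proj₁ (X-prefix-of-aj (position ≤-refl))) (length-++-≤ˡ (X K)))

SumOfTwo : (ℕ → Set) → ℕ → Set
SumOfTwo P n = ∃₂ λ a b → P a × P b × a + b ≡ n

sumOfTwo? : ∀ {P} → Decidable P → ∀ n → Dec (SumOfTwo P n)
sumOfTwo? {P} P? n = map′ fromSplit toSplit (anyUpTo? (λ a → P? a ×-dec P? (n ∸ a)) (suc n))
  where
  fromSplit : (∃ λ a → a < suc n × P a × P (n ∸ a)) → SumOfTwo P n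
  fromSplit (a , s≤s a≤n , Pa , Pb) = a , n ∸ a , Pa , Pb , m+[n∸m]≡n a≤n
  toSplit : SumOfTwo P n → ∃ λ a → a < suc n × P a × P (n ∸ a)
  toSplit (a , b , Pa , Pb , refl) = a , s≤s (m≤m+n a b) , Pa , subst P (sym (m+n∸m≡n a b)) Pb

sums-beyond : ∀ {P c} S → (∀ m → ∃ λ j → j ∈ S × P (m + j)) → All (λ j → j ≤ c × P (c ∸ j)) S
            → ∀ m → SumOfTwo P (m + c)
sums-beyond {c = c} S meets partners m =
  let j , j∈S , Pm+j = meets m
      j≤c , Pc∸j = All.lookup partners j∈S
  in m + j , c ∸ j , Pm+j , Pc∸j , trans (+-assoc m j (c ∸ j)) (cong (m +_) (m+[n∸m]≡n j≤c))

sums-from : ∀ {P l c} S → (∀ m → ∃ λ j → j ∈ S × P (m + j)) → All (λ j → j ≤ c × P (c ∸ j)) S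
          → (∀ {n} → n < c → l ≤ n → SumOfTwo P n) → ∀ n → l ≤ n → SumOfTwo P n
sums-from {P} {c = c} S meets partners below n l≤n with n <? c
... | yes n<c = below n<c l≤n
... | no  n≮c = subst (SumOfTwo P) (m∸n+n≡m (≮⇒≥ n≮c)) (sums-beyond S meets partners (n ∸ c))

J? : ∀ bit → Decidable (J bit)
J? bit a = aj a ≟ᵇ bit

partners? : ∀ bit c → Dec (All (λ j → j ≤ c × J bit (c ∸ j)) offsets)
partners? bit c = All.all? (λ j → (j ≤? c) ×-dec J? bit (c ∸ j)) offsets

sumsBelow? : ∀ bit l c → Dec (∀ {n} → n < c → l ≤ n → SumOfTwo (J bit) n)
sumsBelow? bit l c = allUpTo? (λ n → (l ≤? n) →-dec sumOfTwo? (J? bit) n) c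

theorem43 : ((n : ℕ) → 10 ≤ n → ∃₂ λ a b → J false a × J false b × a + b ≡ n)
    × ((n : ℕ) → 2 ≤ n → ∃₂ λ a b → J true a × J true b × a + b ≡ n)
theorem43 =
  sums-from offsets (offsets-meet-J false) (from-yes (partners? false 17)) (from-yes (sumsBelow? false 10 17)) ,
  sums-from offsets (offsets-meet-J true)  (from-yes (partners? true 41))  (from-yes (sumsBelow? true 2 41))
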